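{- Let $\lambda$ be a partition (with $\lambda_i\ge i$ for all $i$) whose GJW sequence is $(a,1,b)$ for sequences $a,b$, and let $\lambda'$ be the partition whose GJW sequence is $(a,1,0,b)$. Then the rook posets $P_\lambda$ and $P_{\lambda'}$ are isomorphic.
   Context: A partition $\lambda=(\lambda_1\le\cdots\le\lambda_n)$ of positive integers with $\lambda_i\ge i$; its GJW sequence is $(\lambda_i-i)_{i=1}^n$, and a sequence $(g_1,\dots,g_m)$ of nonnegative integers with $g_{i+1}\ge g_i-1$ is the GJW sequence of the partition $(g_i+i)_{i=1}^m$. Ferrers board of $\lambda$: cells $(i,j)$, row $i$ from the bottom, $1\le j\le\lambda_i$. A maximal rook placement is a sequence $x=(x_1,\dots,x_n)$ of distinct integers with $1\le x_i\le\lambda_i$. The rook poset $P_\lambda$: $x\le y$ iff for every $j$ the increasingly sorted list of $\{x_1,\dots,x_j\}$ is entrywise $\le$ that of $\{y_1,\dots,y_j\}$. -}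

module Defs where

open import Data.Nat using (ℕ; zero; suc; _+_; _∸_; _≤_)
open import Data.Nat.Properties using (≤-decTotalOrder)
open import Data.List using (List; []; _∷_; take)
open import Data.List.Relation.Unary.Linked using (Linked)
open import Data.List.Relation.Unary.Unique.Propositional using (Unique)
open import Data.List.Relation.Binary.Pointwise using (Pointwise)
open import Data.Product using (Σ; _×_; proj₁)
open import Relation.Binary.PropositionalEquality using (_≡_)
open import Data.Unit using (⊤)
open import Data.Empty using (⊥)
import Data.List.Sort

open Data.List.Sort ≤-decTotalOrder using (sort)

AboveFrom : ℕ → List ℕ → Set
AboveFrom k []       = ⊤
AboveFrom k (l ∷ ls) = (k ≤ l) × AboveFrom (suc k) ls

-- A partition λ = (λ₁ ≤ ⋯ ≤ λₙ) (listed λ₁ first) with λᵢ ≥ i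
IsPartition : List ℕ → Set
IsPartition λs = Linked _≤_ λs × AboveFrom 1 λs

gjwFrom : ℕ → List ℕ → List ℕ
gjwFrom k []       = []
gjwFrom k (l ∷ ls) = (l ∸ k) ∷ gjwFrom (suc k) ls

gjw : List ℕ → List ℕ
gjw = gjwFrom 1

fromGJWFrom : ℕ → List ℕ → List ℕ
fromGJWFrom k []       = []
fromGJWFrom k (g ∷ gs) = (g + k) ∷ fromGJWFrom (suc k) gs

fromGJW : List ℕ → List ℕ
fromGJW = fromGJWFrom 1

-- maximal rook placement: distinct xᵢ with 1 ≤ xᵢ ≤ λᵢ
IsRook : List ℕ → List ℕ → Set
IsRook λs xs = Pointwise (λ x l → (1 ≤ x) × (x ≤ l)) xs λs × Unique xs

Rook : List ℕ → Set
Rook λs = Σ (List ℕ) (IsRook λs)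

_≤R_ : List ℕ → List ℕ → Set
xs ≤R ys = ∀ (j : ℕ) → Pointwise _≤_ (sort (take j xs)) (sort (take j ys))

record RookIso (λs μs : List ℕ) : Set where
  field
    to       : Rook λs → Rook μs
    from     : Rook μs → Rook λs
    from∘to  : ∀ x → proj₁ (from (to x)) ≡ proj₁ x
    to∘from  : ∀ y → proj₁ (to (from y)) ≡ proj₁ y
    to-mono  : ∀ x y → proj₁ x ≤R proj₁ y → proj₁ (to x) ≤R proj₁ (to y)
    to-refl  : ∀ x y → proj₁ (to x) ≤R proj₁ (to y) → proj₁ x ≤R proj₁ y

{-# OPTIONS --safe #-}
-- Write λ = H ++ L, where H = (λ₁, …, λ_K) ends with the row λ_K = K + 1 (the entry 1 of the
-- GJW sequence) and L holds the remaining rows; then λ′ = H ++ (K + 1) ∷ (L shifted up by one).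
-- A placement on λ puts K distinct columns of 1 … K + 1 into the rows of H, so exactly one
-- column m of 1 … K + 1 is free there, and a placement on λ′ must put m into its new row K + 1.
-- The isomorphism inserts m as row K + 1 and relabels the rows above: column m (if used there)
-- becomes K + 2, and every column beyond K + 1 moves up by one.
-- The order is compared through counts: x ≤ y iff every prefix of y has at most as many entries
-- ≤ t as the prefix of x of the same length. Prefixes of length ≤ K are untouched; longer
-- prefixes of an image contain all of 1 … K + 1, and above K + 1 their counts are those of x
-- shifted by one. For the converse at t ≤ K: if the prefix of y uses its free column, then
-- comparing counts at K + 1 so does the prefix of x, which then contains every column ≤ K + 1.
module Submission where

open import Data.Nat
open import Data.Nat.Properties
open import Algebra.Properties.CommutativeSemigroup +-commutativeSemigroup using (x∙yz≈y∙xz)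
open import Data.List using (List; []; _∷_; [_]; _++_; length; take; drop; map)
open import Data.List.Membership.DecPropositional _≟_ using (_∈?_)
open import Data.List.Membership.Propositional using (_∈_; _∉_)
open import Data.List.Membership.Propositional.Properties using (∈-map⁻; ∈-++⁺ʳ)
open import Data.List.Properties using (length-take; take-map; map-∘; map-id-local; length-++; ++-assoc)
open import Data.List.Relation.Binary.Disjoint.Propositional using (Disjoint)
open import Data.List.Relation.Binary.Permutation.Propositional as ↭ using (_↭_; prep; swap)
open import Data.List.Relation.Binary.Permutation.Propositional.Properties using (↭-length; shift)
open import Data.List.Relation.Binary.Pointwise as Pointwise using (Pointwise; []; _∷_; Pointwise-length)
open import Data.List.Relation.Unary.All as All using (All; []; _∷_)
open import Data.List.Relation.Unary.All.Properties
  using (All¬⇒¬Any; ¬Any⇒All¬; ++⁺; ++⁻ˡ; ++⁻ʳ; map⁺; take⁺)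
open import Data.List.Relation.Unary.AllPairs as AllPairs using ([]; _∷_)
open import Data.List.Relation.Unary.Any using (here; there)
open import Data.List.Relation.Unary.Linked as Linked using ()
open import Data.List.Relation.Unary.Linked.Properties using (Linked⇒All)
open import Data.List.Relation.Unary.Sorted.TotalOrder ≤-totalOrder using (Sorted)
open import Data.List.Relation.Unary.Unique.Propositional using (Unique)
import Data.List.Relation.Unary.Unique.Propositional.Properties as Unique
import Data.List.Sort
open import Data.Product using (_×_; _,_; ∃₂; proj₁; proj₂)
open import Data.Sum using (_⊎_; inj₁; inj₂; [_,_]′)
open import Function using (_∘_; id)
open import Relation.Binary.PropositionalEquality as ≡
  using (_≡_; _≢_; refl; cong; cong₂; sym; trans; subst; subst₂)
open import Relation.Nullary using (yes; no)
open import Relation.Nullary.Negation using (contradiction)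

open import Defs

open Data.List.Sort ≤-decTotalOrder using (sort; sort-↭; sort-↗)

count≤ : ℕ → List ℕ → ℕ
count≤ t []       = 0
count≤ t (x ∷ xs) with x ≤? t
... | yes _ = suc (count≤ t xs)
... | no _  = count≤ t xs

count≤-++ : ∀ t xs ys → count≤ t (xs ++ ys) ≡ count≤ t xs + count≤ t ys
count≤-++ t []       ys = refl
count≤-++ t (x ∷ xs) ys with x ≤? t
... | yes _ = cong suc (count≤-++ t xs ys)
... | no _  = count≤-++ t xs ys

count≤-↭ : ∀ t {xs ys} → xs ↭ ys → count≤ t xs ≡ count≤ t ys
count≤-↭ t ↭.refl      = refl
count≤-↭ t (prep x p) with x ≤? t
... | yes _ = cong suc (count≤-↭ t p)
... | no _  = count≤-↭ t p
count≤-↭ t (swap {xs} {ys} x y p) = begin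
  count≤ t ([ x ] ++ [ y ] ++ xs)  ≡⟨ count≤-++ t [ x ] _ ⟩
  cx + count≤ t ([ y ] ++ xs)      ≡⟨ cong (cx +_) (count≤-++ t [ y ] xs) ⟩
  cx + (cy + count≤ t xs)          ≡⟨ x∙yz≈y∙xz cx cy (count≤ t xs) ⟩
  cy + (cx + count≤ t xs)          ≡⟨ cong (λ n → cy + (cx + n)) (count≤-↭ t p) ⟩
  cy + (cx + count≤ t ys)          ≡⟨ cong (cy +_) (count≤-++ t [ x ] ys) ⟨
  cy + count≤ t ([ x ] ++ ys)      ≡⟨ count≤-++ t [ y ] _ ⟨
  count≤ t ([ y ] ++ [ x ] ++ ys)  ∎
  where
  open ≡.≡-Reasoning
  cx = count≤ t [ x ]
  cy = count≤ t [ y ]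
count≤-↭ t (↭.trans p q) = trans (count≤-↭ t p) (count≤-↭ t q)

count≤-none : ∀ {t xs} → All (t <_) xs → count≤ t xs ≡ 0
count≤-none [] = refl
count≤-none {t} (_∷_ {x} t<x t<xs) with x ≤? t
... | yes x≤t = contradiction x≤t (<⇒≱ t<x)
... | no _    = count≤-none t<xs

count≤-all : ∀ {t xs} → All (_≤ t) xs → count≤ t xs ≡ length xs
count≤-all [] = refl
count≤-all {t} (_∷_ {x} x≤t xs≤t) with x ≤? t
... | yes _   = cong suc (count≤-all xs≤t)
... | no x≰t  = contradiction x≤t x≰t

count≤-∷-pos : ∀ {t x} xs → x ≤ t → 0 < count≤ t (x ∷ xs)
count≤-∷-pos {t} {x} xs x≤t with x ≤? t
... | yes _   = s≤s z≤n
... | no x≰t  = contradiction x≤t x≰t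

count≤-mono : ∀ {s t} xs → s ≤ t → count≤ s xs ≤ count≤ t xs
count≤-mono [] s≤t = z≤n
count≤-mono {s} {t} (x ∷ xs) s≤t with x ≤? s | x ≤? t
... | yes _   | yes _  = s≤s (count≤-mono xs s≤t)
... | yes x≤s | no x≰t = contradiction (≤-trans x≤s s≤t) x≰t
... | no _    | yes _  = m≤n⇒m≤1+n (count≤-mono xs s≤t)
... | no _    | no _   = count≤-mono xs s≤t

count≤-antitone : ∀ t {xs ys} → Pointwise _≤_ xs ys → count≤ t ys ≤ count≤ t xs
count≤-antitone t [] = z≤n
count≤-antitone t (_∷_ {x} {y} x≤y xs≤ys) with x ≤? t | y ≤? t
... | yes _  | yes _   = s≤s (count≤-antitone t xs≤ys)
... | yes _  | no _    = m≤n⇒m≤1+n (count≤-antitone t xs≤ys)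
... | no x≰t | yes y≤t = contradiction (≤-trans x≤y y≤t) x≰t
... | no _   | no _    = count≤-antitone t xs≤ys

count≤-∈ : ∀ {s xs} → suc s ∈ xs → count≤ s xs < count≤ (suc s) xs
count≤-∈ {s} {x ∷ xs} (here refl) with suc s ≤? s | suc s ≤? suc s
... | yes ss≤s | _        = contradiction ss≤s (n≮n s)
... | no _     | no ss≰ss = contradiction ≤-refl ss≰ss
... | no _     | yes _    = s≤s (count≤-mono xs (n≤1+n s))
count≤-∈ {s} {x ∷ xs} (there ss∈xs) with x ≤? s | x ≤? suc s
... | yes _   | yes _   = s≤s (count≤-∈ ss∈xs)
... | yes x≤s | no x≰ss = contradiction (m≤n⇒m≤1+n x≤s) x≰ss
... | no _    | yes _   = m≤n⇒m≤1+n (count≤-∈ ss∈xs)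
... | no _    | no _    = count≤-∈ ss∈xs

count≤-∉ : ∀ {s xs} → suc s ∉ xs → count≤ (suc s) xs ≤ count≤ s xs
count≤-∉ {s} {[]}     _       = z≤n
count≤-∉ {s} {x ∷ xs} ss∉x∷xs with x ≤? suc s | x ≤? s
... | yes _    | yes _   = s≤s (count≤-∉ (ss∉x∷xs ∘ there))
... | yes x≤ss | no x≰s  = contradiction (here (≤-antisym (≰⇒> x≰s) x≤ss)) ss∉x∷xs
... | no x≰ss  | yes x≤s = contradiction (m≤n⇒m≤1+n x≤s) x≰ss
... | no _     | no _    = count≤-∉ (ss∉x∷xs ∘ there)

count≤-suc : ∀ s {xs} → Unique xs → count≤ (suc s) xs ≤ suc (count≤ s xs)
count≤-suc s [] = z≤n
count≤-suc s {x ∷ xs} (x∉xs ∷ xs!) with x ≤? suc s | x ≤? s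
... | yes _    | yes _   = s≤s (count≤-suc s xs!)
... | yes x≤ss | no x≰s  =
  s≤s (count≤-∉ (subst (_∉ xs) (≤-antisym x≤ss (≰⇒> x≰s)) (All¬⇒¬Any x∉xs)))
... | no x≰ss  | yes x≤s = contradiction (m≤n⇒m≤1+n x≤s) x≰ss
... | no _     | no _    = count≤-suc s xs!

count≤-+ : ∀ s d {xs} → Unique xs → count≤ (s + d) xs ≤ count≤ s xs + d
count≤-+ s zero    {xs} xs! =
  ≤-reflexive (trans (cong (λ n → count≤ n xs) (+-identityʳ s)) (sym (+-identityʳ _)))
count≤-+ s (suc d) {xs} xs! = begin
  count≤ (s + suc d) xs    ≡⟨ cong (λ n → count≤ n xs) (+-suc s d) ⟩
  count≤ (suc (s + d)) xs  ≤⟨ count≤-suc (s + d) xs! ⟩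
  suc (count≤ (s + d) xs)  ≤⟨ s≤s (count≤-+ s d xs!) ⟩
  suc (count≤ s xs + d)    ≡⟨ +-suc _ d ⟨
  count≤ s xs + suc d      ∎
  where open ≤-Reasoning

count≤-≤ : ∀ t {xs} → Unique xs → All (1 ≤_) xs → count≤ t xs ≤ t
count≤-≤ t {xs} xs! xs⁺ = begin
  count≤ (0 + t) xs  ≤⟨ count≤-+ 0 t xs! ⟩
  count≤ 0 xs + t    ≡⟨ cong (_+ t) (count≤-none xs⁺) ⟩
  t                  ∎
  where open ≤-Reasoning

count≤-full : ∀ {n t xs} → Unique xs → n ≤ count≤ n xs → t ≤ n → t ≤ count≤ t xs
count≤-full {n} {t} {xs} xs! n≤ t≤n with d , refl ← m≤n⇒∃[o]m+o≡n t≤n =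
  +-cancelʳ-≤ d t (count≤ t xs) (≤-trans n≤ (count≤-+ t d xs!))

-- Either V has no entry ≤ n, so the comparison at t reduces to B and A, or V has one and then
-- A ++ W contains all of 1 … n.
count≤-++-dominance : ∀ {n t A B W V} → t ≤ n → Unique (A ++ W) → Unique (B ++ V) → All (1 ≤_) (B ++ V) →
                      n ≤ suc (count≤ n B) → count≤ t B ≤ count≤ t A →
                      count≤ n (B ++ V) ≤ count≤ n (A ++ W) → count≤ t (B ++ V) ≤ count≤ t (A ++ W)
count≤-++-dominance {n} {t} {A} {B} {W} {V} t≤n A++W! B++V! B++V⁺ B-almost-full B≼A B++V≼A++W
  with count≤ n V in V-count
... | zero = begin
  count≤ t (B ++ V)        ≡⟨ count≤-++ t B V ⟩
  count≤ t B + count≤ t V  ≤⟨ +-mono-≤ B≼A (≤-trans (count≤-mono V t≤n) (≤-reflexive V-count)) ⟩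
  count≤ t A + 0           ≤⟨ +-monoʳ-≤ (count≤ t A) z≤n ⟩
  count≤ t A + count≤ t W  ≡⟨ count≤-++ t A W ⟨
  count≤ t (A ++ W)        ∎
  where open ≤-Reasoning
... | suc k = ≤-trans (count≤-≤ t B++V! B++V⁺) (count≤-full A++W! A++W-full t≤n)
  where
  open ≤-Reasoning
  A++W-full : n ≤ count≤ n (A ++ W)
  A++W-full = begin
    n                        ≤⟨ B-almost-full ⟩
    suc (count≤ n B)         ≡⟨ +-comm 1 (count≤ n B) ⟩
    count≤ n B + 1           ≤⟨ +-monoʳ-≤ (count≤ n B) (s≤s z≤n) ⟩
    count≤ n B + suc k       ≡⟨ cong (count≤ n B +_) V-count ⟨
    count≤ n B + count≤ n V  ≡⟨ count≤-++ n B V ⟨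
    count≤ n (B ++ V)        ≤⟨ B++V≼A++W ⟩
    count≤ n (A ++ W)        ∎

sorted-head≤ : ∀ {x xs} → Sorted (x ∷ xs) → All (x ≤_) (x ∷ xs)
sorted-head≤ = Linked⇒All ≤-trans ≤-refl

count≤-sorted-< : ∀ {t x xs} → Sorted (x ∷ xs) → t < x → count≤ t (x ∷ xs) ≡ 0
count≤-sorted-< x∷xs↗ t<x = count≤-none (All.map (<-≤-trans t<x) (sorted-head≤ x∷xs↗))

sorted-pointwise-≤ : ∀ {xs ys} → Sorted xs → Sorted ys → length xs ≡ length ys →
                     (∀ t → count≤ t ys ≤ count≤ t xs) → Pointwise _≤_ xs ys
sorted-pointwise-≤ {[]}     {[]}     _     _     _         _   = []
sorted-pointwise-≤ {x ∷ xs} {y ∷ ys} x∷xs↗ y∷ys↗ |xs|≡|ys| dom =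
  x≤y ∷ sorted-pointwise-≤ (Linked.tail x∷xs↗) (Linked.tail y∷ys↗) (suc-injective |xs|≡|ys|) dom-tail
  where
  x≤y : x ≤ y
  x≤y with x ≤? y
  ... | yes x≤y = x≤y
  ... | no x≰y  = contradiction 0<0 (<-irrefl refl)
    where
    open ≤-Reasoning
    0<0 : 0 < 0
    0<0 = begin-strict
      0                  <⟨ count≤-∷-pos {y} ys ≤-refl ⟩
      count≤ y (y ∷ ys)  ≤⟨ dom y ⟩
      count≤ y (x ∷ xs)  ≡⟨ count≤-sorted-< x∷xs↗ (≰⇒> x≰y) ⟩
      0                  ∎
  dom-tail : ∀ t → count≤ t ys ≤ count≤ t xs
  dom-tail t with y ≤? t | x ≤? t | dom t
  ... | no y≰t  | _      | _        = subst (_≤ count≤ t xs) (sym ys-none) z≤n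
    where
    ys-none : count≤ t ys ≡ 0
    ys-none = count≤-none (All.map (<-≤-trans (≰⇒> y≰t)) (All.tail (sorted-head≤ y∷ys↗)))
  ... | yes _   | yes _  | s≤s dom′ = dom′
  ... | yes y≤t | no x≰t | _        = contradiction (≤-trans x≤y y≤t) x≰t

_⊑_ : List ℕ → List ℕ → Set
xs ⊑ ys = ∀ j t → count≤ t (take j ys) ≤ count≤ t (take j xs)

≤R⇒⊑ : ∀ {xs ys} → xs ≤R ys → xs ⊑ ys
≤R⇒⊑ {xs} {ys} xs≤ys j t = subst₂ _≤_ (count≤-↭ t (sort-↭ (take j ys))) (count≤-↭ t (sort-↭ (take j xs)))
                                      (count≤-antitone t (xs≤ys j))

⊑⇒≤R : ∀ {xs ys} → length xs ≡ length ys → xs ⊑ ys → xs ≤R ys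
⊑⇒≤R {xs} {ys} |xs|≡|ys| xs⊑ys j = sorted-pointwise-≤ (sort-↗ (take j xs)) (sort-↗ (take j ys)) same-length
  (λ t → subst₂ _≤_ (sym (count≤-↭ t (sort-↭ (take j ys)))) (sym (count≤-↭ t (sort-↭ (take j xs))))
                    (xs⊑ys j t))
  where
  same-length : length (sort (take j xs)) ≡ length (sort (take j ys))
  same-length = begin
    length (sort (take j xs))  ≡⟨ ↭-length (sort-↭ (take j xs)) ⟩
    length (take j xs)         ≡⟨ length-take j xs ⟩
    j ⊓ length xs              ≡⟨ cong (j ⊓_) |xs|≡|ys| ⟩
    j ⊓ length ys              ≡⟨ length-take j ys ⟨
    length (take j ys)         ≡⟨ ↭-length (sort-↭ (take j ys)) ⟨
    length (sort (take j ys))  ∎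
    where open ≡.≡-Reasoning

take-++-≤ : ∀ {j} (xs : List ℕ) {ys} → j ≤ length xs → take j (xs ++ ys) ≡ take j xs
take-++-≤ {zero}  xs       _         = refl
take-++-≤ {suc j} (x ∷ xs) (s≤s j≤n) = cong (x ∷_) (take-++-≤ xs j≤n)

take-++-+ : ∀ (xs : List ℕ) {ys} i → take (length xs + i) (xs ++ ys) ≡ xs ++ take i ys
take-++-+ []       i = refl
take-++-+ (x ∷ xs) i = cong (x ∷_) (take-++-+ xs i)

take-length-++ : ∀ (xs : List ℕ) {ys} → take (length xs) (xs ++ ys) ≡ xs
take-length-++ []       = refl
take-length-++ (x ∷ xs) = cong (x ∷_) (take-length-++ xs)

drop-length-++ : ∀ (xs : List ℕ) {ys} → drop (length xs) (xs ++ ys) ≡ ys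
drop-length-++ []       = refl
drop-length-++ (x ∷ xs) = drop-length-++ xs

Pointwise-++⁻ : ∀ {R : ℕ → ℕ → Set} ys {zs xs} → Pointwise R xs (ys ++ zs) →
                ∃₂ λ as bs → xs ≡ as ++ bs × Pointwise R as ys × Pointwise R bs zs
Pointwise-++⁻ []       xs∼zs         = [] , _ , refl , [] , xs∼zs
Pointwise-++⁻ (y ∷ ys) (x∼y ∷ xs∼ys) with as , bs , refl , as∼ys , bs∼zs ← Pointwise-++⁻ ys xs∼ys =
  _ ∷ as , bs , refl , x∼y ∷ as∼ys , bs∼zs

Unique-++⁻ : ∀ (xs : List ℕ) {ys} → Unique (xs ++ ys) → Unique xs × Unique ys × Disjoint xs ys
Unique-++⁻ []       ys!              = [] , ys! , λ ()
Unique-++⁻ (x ∷ xs) (x∉ ∷ xs++ys!) with xs! , ys! , xs#ys ← Unique-++⁻ xs xs++ys! =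
  ++⁻ˡ xs x∉ ∷ xs! , ys! , λ where
    (here refl , v∈ys)  → All.lookup (++⁻ʳ xs x∉) v∈ys refl
    (there v∈xs , v∈ys) → xs#ys (v∈xs , v∈ys)

Unique-map⁺-on : ∀ {P : ℕ → Set} {f : ℕ → ℕ} {xs} → (∀ {v w} → P v → P w → f v ≡ f w → v ≡ w) →
                 All P xs → Unique xs → Unique (map f xs)
Unique-map⁺-on inj []         []           = []
Unique-map⁺-on inj (px ∷ pxs) (x∉xs ∷ xs!) =
  map⁺ (All.zipWith (λ (py , x≢y) → x≢y ∘ inj px py) (pxs , x∉xs)) ∷ Unique-map⁺-on inj pxs xs!

data Cut (K : ℕ) : ℕ → Set where
  below : ∀ {j} → j ≤ K → Cut K j
  above : ∀ i → Cut K (K + suc i)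

cut : ∀ K j → Cut K j
cut zero    zero    = below z≤n
cut zero    (suc i) = above i
cut (suc K) zero    = below z≤n
cut (suc K) (suc j) with cut K j
... | below j≤K = below (s≤s j≤K)
... | above i   = above i

_InRow_ : ℕ → ℕ → Set
x InRow l = 1 ≤ x × x ≤ l

rooks-same-length : ∀ {μ x y} → IsRook μ x → IsRook μ y → length x ≡ length y
rooks-same-length (x-rows , _) (y-rows , _) = trans (Pointwise-length x-rows) (sym (Pointwise-length y-rows))

rows-positive : ∀ {xs ls} → Pointwise _InRow_ xs ls → All (1 ≤_) xs
rows-positive []               = []
rows-positive ((1≤x , _) ∷ rs) = 1≤x ∷ rows-positive rs

rows-within : ∀ {n xs ls} → Pointwise _InRow_ xs ls → All (_≤ n) ls → All (_InRow n) xs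
rows-within []                 []           = []
rows-within ((1≤x , x≤l) ∷ rs) (l≤n ∷ ls≤n) = (1≤x , ≤-trans x≤l l≤n) ∷ rows-within rs ls≤n

-- 0 when every value in 1 … t occurs in xs.
maxAbsent : ℕ → List ℕ → ℕ
maxAbsent zero    xs = zero
maxAbsent (suc s) xs with suc s ∈? xs
... | yes _ = maxAbsent s xs
... | no _  = suc s

maxAbsent-spec : ∀ t {xs} → count≤ t xs < t → maxAbsent t xs InRow t × maxAbsent t xs ∉ xs
maxAbsent-spec (suc s) {xs} c<t with suc s ∈? xs
... | no ss∉xs  = (s≤s z≤n , ≤-refl) , ss∉xs
... | yes ss∈xs with (1≤m , m≤s) , m∉xs ← maxAbsent-spec s (≤-trans (count≤-∈ ss∈xs) (≤-pred c<t)) =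
  (1≤m , m≤n⇒m≤1+n m≤s) , m∉xs

-- The columns usable above row K when m is the column of 1 … K + 1 left free by the first K rows.
Free : ℕ → ℕ → ℕ → Set
Free K m v = v ≡ m ⊎ suc K < v

module MissingValue {K : ℕ} {A : List ℕ} (A! : Unique A) (A-rows : All (_InRow suc K) A)
                    (|A|≡K : length A ≡ K) where

  missing : ℕ
  missing = maxAbsent (suc K) A

  A≤ : ∀ {s} → suc K ≤ s → All (_≤ s) A
  A≤ K<s = All.map (λ (_ , v≤) → ≤-trans v≤ K<s) A-rows

  count≤-A-≥ : ∀ {s} → suc K ≤ s → count≤ s A ≡ K
  count≤-A-≥ K<s = trans (count≤-all (A≤ K<s)) |A|≡K

  missing-InRow : missing InRow suc K
  missing-InRow = proj₁ (maxAbsent-spec (suc K) {A} (s≤s (≤-reflexive (count≤-A-≥ ≤-refl))))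

  missing-∉ : missing ∉ A
  missing-∉ = proj₂ (maxAbsent-spec (suc K) {A} (s≤s (≤-reflexive (count≤-A-≥ ≤-refl))))

  A⁺ : All (1 ≤_) A
  A⁺ = All.map proj₁ A-rows

  missing∷A! : Unique (missing ∷ A)
  missing∷A! = ¬Any⇒All¬ A missing-∉ ∷ A!

  absent⇒missing : ∀ {v} → v InRow suc K → v ∉ A → v ≡ missing
  absent⇒missing {v} (1≤v , v≤) v∉A with v ≟ missing
  ... | yes v≡m = v≡m
  ... | no v≢m  = contradiction (count≤-≤ (suc K) v∷m∷A! (1≤v ∷ proj₁ missing-InRow ∷ A⁺)) (<⇒≱ too-many)
    where
    v∷m∷A! : Unique (v ∷ missing ∷ A)
    v∷m∷A! = (v≢m ∷ ¬Any⇒All¬ A v∉A) ∷ missing∷A!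
    too-many : suc (suc K) ≤ count≤ (suc K) (v ∷ missing ∷ A)
    too-many = ≤-reflexive (sym (trans (count≤-all (v≤ ∷ proj₂ missing-InRow ∷ A≤ ≤-refl))
                                       (cong (suc ∘ suc) |A|≡K)))

  count≤-missing∷A-≥ : ∀ {s} → suc K ≤ s → count≤ s (missing ∷ A) ≡ suc K
  count≤-missing∷A-≥ K<s = trans (count≤-all (≤-trans (proj₂ missing-InRow) K<s ∷ A≤ K<s)) (cong suc |A|≡K)

  count≤-missing∷A-≤ : ∀ {t} → t ≤ suc K → count≤ t (missing ∷ A) ≡ t
  count≤-missing∷A-≤ {t} t≤ =
    ≤-antisym (count≤-≤ t missing∷A! (proj₁ missing-InRow ∷ A⁺))
              (count≤-full missing∷A! (≤-reflexive (sym (count≤-missing∷A-≥ ≤-refl))) t≤)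

  free-∉ : ∀ {v} → Free K missing v → v ∉ A
  free-∉ (inj₁ refl)    = missing-∉
  free-∉ (inj₂ K<v) v∈A = <⇒≱ K<v (proj₂ (All.lookup A-rows v∈A))

  ∉⇒free : ∀ {v} → 1 ≤ v → v ∉ A → Free K missing v
  ∉⇒free {v} 1≤v v∉A with v ≤? suc K
  ... | yes v≤ = inj₁ (absent⇒missing (1≤v , v≤) v∉A)
  ... | no v≰  = inj₂ (≰⇒> v≰)

module RowInsertion (K : ℕ) (H L : List ℕ) (|H|≡K : length H ≡ K)
                    (H≤ : All (_≤ suc K) H) (L≥ : All (suc K ≤_) L) where

  -- Only the missing column can occur above row K among 1 … suc K; it goes to suc (suc K).
  raise : ℕ → ℕ
  raise v = suc (v ⊔ suc K)

  lower : ℕ → ℕ → ℕ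
  lower m z with z ≟ suc (suc K)
  ... | yes _ = m
  ... | no _  = pred z

  insertRow : List ℕ → List ℕ
  insertRow x = take K x ++ maxAbsent (suc K) (take K x) ∷ map raise (drop K x)

  lowerTail : List ℕ → List ℕ
  lowerTail []      = []
  lowerTail (m ∷ z) = map (lower m) z

  deleteRow : List ℕ → List ℕ
  deleteRow y = take K y ++ lowerTail (drop K y)

  raise-> : ∀ v → suc K < raise v
  raise-> v = s≤s (m≤n⊔m v (suc K))

  raise-above : ∀ {v} → suc K < v → raise v ≡ suc v
  raise-above K<v = cong suc (m≥n⇒m⊔n≡m (<⇒≤ K<v))

  raise-InRow : ∀ {v l} → v InRow l → suc K ≤ l → raise v InRow suc l
  raise-InRow (_ , v≤l) K≤l = s≤s z≤n , s≤s (⊔-lub v≤l K≤l)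

  lower-top : ∀ m → lower m (suc (suc K)) ≡ m
  lower-top m with suc (suc K) ≟ suc (suc K)
  ... | yes _      = refl
  ... | no K+2≢K+2 = contradiction refl K+2≢K+2

  lower-pred : ∀ m {z} → z ≢ suc (suc K) → lower m z ≡ pred z
  lower-pred m {z} z≢ with z ≟ suc (suc K)
  ... | yes z≡K+2 = contradiction z≡K+2 z≢
  ... | no _      = refl

  lower-free : ∀ {m z} → suc K < z → Free K m (lower m z)
  lower-free {m} {suc z} (s≤s K≤z) with suc z ≟ suc (suc K)
  ... | yes _ = inj₁ refl
  ... | no z≢ = inj₂ (≤∧≢⇒< K≤z (z≢ ∘ cong suc ∘ sym))

  lower-InRow : ∀ {m z l} → m InRow suc K → suc K < z → z ≤ suc l → suc K ≤ l → lower m z InRow l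
  lower-InRow {m} {suc z} (1≤m , m≤) (s≤s K≤z) (s≤s z≤l) K≤l with suc z ≟ suc (suc K)
  ... | yes _ = 1≤m , ≤-trans m≤ K≤l
  ... | no _  = ≤-trans (s≤s z≤n) K≤z , z≤l

  lower∘raise : ∀ {m v} → m ≤ suc K → Free K m v → lower m (raise v) ≡ v
  lower∘raise {m} m≤ (inj₁ refl) = trans (cong (lower m ∘ suc) (m≤n⇒m⊔n≡n m≤)) (lower-top m)
  lower∘raise {m} m≤ (inj₂ K<v)  =
    trans (cong (lower m) (raise-above K<v)) (lower-pred m (<⇒≢ (s≤s K<v) ∘ sym))

  raise∘lower : ∀ {m z} → m ≤ suc K → suc K < z → raise (lower m z) ≡ z
  raise∘lower {m} {suc z} m≤ (s≤s K≤z) with suc z ≟ suc (suc K)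
  ... | yes refl = cong suc (m≤n⇒m⊔n≡n m≤)
  ... | no _     = cong suc (m≥n⇒m⊔n≡m K≤z)

  raise-injective : ∀ {m v w} → m ≤ suc K → Free K m v → Free K m w → raise v ≡ raise w → v ≡ w
  raise-injective {m} m≤ v-free w-free rv≡rw =
    trans (sym (lower∘raise m≤ v-free)) (trans (cong (lower m) rv≡rw) (lower∘raise m≤ w-free))

  lower-injective : ∀ {m z z′} → m ≤ suc K → suc K < z → suc K < z′ → lower m z ≡ lower m z′ → z ≡ z′
  lower-injective m≤ K<z K<z′ lz≡lz′ =
    trans (sym (raise∘lower m≤ K<z)) (trans (cong raise lz≡lz′) (raise∘lower m≤ K<z′))

  count≤-raise-≤ : ∀ {t} W → t ≤ suc K → count≤ t (map raise W) ≡ 0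
  count≤-raise-≤ W t≤ = count≤-none (map⁺ (All.tabulate {xs = W} (λ {v} _ → ≤-<-trans t≤ (raise-> v))))

  count≤-raise-≥ : ∀ {s} W → suc K ≤ s → count≤ (suc s) (map raise W) ≡ count≤ s W
  count≤-raise-≥         []      K≤s = refl
  count≤-raise-≥ {s} (w ∷ W) K≤s with raise w ≤? suc s | w ≤? s
  ... | yes _    | yes _  = cong suc (count≤-raise-≥ W K≤s)
  ... | yes rw≤  | no w≰  = contradiction (≤-trans (m≤m⊔n w (suc K)) (≤-pred rw≤)) w≰
  ... | no rw≰   | yes w≤ = contradiction (s≤s (⊔-lub w≤ K≤s)) rw≰
  ... | no _     | no _   = count≤-raise-≥ W K≤s

  raise-rows : ∀ {T L′} → Pointwise _InRow_ T L′ → All (suc K ≤_) L′ →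
               Pointwise _InRow_ (map raise T) (map suc L′)
  raise-rows []       []           = []
  raise-rows (r ∷ rs) (K≤l ∷ K≤ls) = raise-InRow r K≤l ∷ raise-rows rs K≤ls

  lower-rows : ∀ {m Z L′} → m InRow suc K → All (suc K <_) Z → Pointwise _InRow_ Z (map suc L′) →
               All (suc K ≤_) L′ → Pointwise _InRow_ (map (lower m) Z) L′
  lower-rows {L′ = []}    m-row []           []              []           = []
  lower-rows {L′ = _ ∷ _} m-row (K<z ∷ K<zs) ((_ , z≤) ∷ rs) (K≤l ∷ K≤ls) =
    lower-InRow m-row K<z z≤ K≤l ∷ lower-rows m-row K<zs rs K≤ls

  λ₁ λ₂ : List ℕ
  λ₁ = H ++ L
  λ₂ = H ++ suc K ∷ map suc L

  data Rook₁ : List ℕ → Set where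
    rook₁ : ∀ {A T} → Pointwise _InRow_ A H → Pointwise _InRow_ T L → Unique (A ++ T) → Rook₁ (A ++ T)

  view₁ : ∀ {x} → IsRook λ₁ x → Rook₁ x
  view₁ (rows , x!) with A , T , refl , A-rows , T-rows ← Pointwise-++⁻ H rows = rook₁ A-rows T-rows x!

  data Rook₂ : List ℕ → Set where
    rook₂ : ∀ {A m Z} → Pointwise _InRow_ A H → m InRow suc K → Pointwise _InRow_ Z (map suc L) →
            Unique (A ++ m ∷ Z) → Rook₂ (A ++ m ∷ Z)

  view₂ : ∀ {y} → IsRook λ₂ y → Rook₂ y
  view₂ (rows , y!) with A , _ , refl , A-rows , m-row ∷ Z-rows ← Pointwise-++⁻ H rows =
    rook₂ A-rows m-row Z-rows y!

  module FirstRows {A} (A-rows : Pointwise _InRow_ A H) (A! : Unique A) where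

    |A|≡K : length A ≡ K
    |A|≡K = trans (Pointwise-length A-rows) |H|≡K

    open MissingValue A! (rows-within A-rows H≤) |A|≡K public

    prefix-≤ : ∀ {j} W → j ≤ K → take j (A ++ W) ≡ take j A
    prefix-≤ W j≤K = take-++-≤ A (≤-trans j≤K (≤-reflexive (sym |A|≡K)))

    prefix-+ : ∀ W i → take (K + i) (A ++ W) ≡ A ++ take i W
    prefix-+ W i = subst (λ k → take (k + i) (A ++ W) ≡ A ++ take i W) |A|≡K (take-++-+ A i)

    prefix-K : ∀ W → take K (A ++ W) ≡ A
    prefix-K W = subst (λ k → take k (A ++ W) ≡ A) |A|≡K (take-length-++ A)

    suffix-K : ∀ W → drop K (A ++ W) ≡ W
    suffix-K W = subst (λ k → drop k (A ++ W) ≡ W) |A|≡K (drop-length-++ A)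

    insertRow-++ : ∀ T → insertRow (A ++ T) ≡ A ++ missing ∷ map raise T
    insertRow-++ T = cong₂ (λ A′ T′ → A′ ++ maxAbsent (suc K) A′ ∷ map raise T′) (prefix-K T) (suffix-K T)

    deleteRow-++ : ∀ m Z → deleteRow (A ++ m ∷ Z) ≡ A ++ map (lower m) Z
    deleteRow-++ m Z = cong₂ (λ A′ T′ → A′ ++ lowerTail T′) (prefix-K (m ∷ Z)) (suffix-K (m ∷ Z))

    inserted-below : ∀ T {j} → j ≤ K → take j (A ++ missing ∷ map raise T) ≡ take j (A ++ T)
    inserted-below T j≤K = trans (prefix-≤ (missing ∷ map raise T) j≤K) (sym (prefix-≤ T j≤K))

    inserted-prefix : ∀ T i → take (K + suc i) (A ++ missing ∷ map raise T) ≡ A ++ missing ∷ map raise (take i T)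
    inserted-prefix T i =
      trans (prefix-+ (missing ∷ map raise T) (suc i)) (cong (λ W → A ++ missing ∷ W) (take-map i T))

    count≤-inserted-≤ : ∀ T i {t} → t ≤ suc K →
                        count≤ t (take (K + suc i) (A ++ missing ∷ map raise T)) ≡ t
    count≤-inserted-≤ T i {t} t≤ = begin
      count≤ t (take (K + suc i) (A ++ missing ∷ map raise T))  ≡⟨ cong (count≤ t) (inserted-prefix T i) ⟩
      count≤ t (A ++ missing ∷ W)                               ≡⟨ count≤-↭ t (shift missing A W) ⟩
      count≤ t (missing ∷ A ++ W)                               ≡⟨ count≤-++ t (missing ∷ A) W ⟩
      count≤ t (missing ∷ A) + count≤ t W                       ≡⟨ cong₂ _+_ (count≤-missing∷A-≤ t≤)
                                                                             (count≤-raise-≤ (take i T) t≤) ⟩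
      t + 0                                                     ≡⟨ +-identityʳ t ⟩
      t                                                         ∎
      where
      open ≡.≡-Reasoning
      W = map raise (take i T)

    count≤-inserted-≥ : ∀ T i {s} → suc K ≤ s →
      count≤ (suc s) (take (K + suc i) (A ++ missing ∷ map raise T)) ≡ suc (count≤ s (take (K + i) (A ++ T)))
    count≤-inserted-≥ T i {s} K≤s = begin
      count≤ (suc s) (take (K + suc i) (A ++ missing ∷ map raise T))
        ≡⟨ cong (count≤ (suc s)) (inserted-prefix T i) ⟩
      count≤ (suc s) (A ++ missing ∷ map raise W)
        ≡⟨ count≤-↭ (suc s) (shift missing A _) ⟩
      count≤ (suc s) (missing ∷ A ++ map raise W)
        ≡⟨ count≤-++ (suc s) (missing ∷ A) _ ⟩
      count≤ (suc s) (missing ∷ A) + count≤ (suc s) (map raise W)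
        ≡⟨ cong₂ _+_ (count≤-missing∷A-≥ (m≤n⇒m≤1+n K≤s)) (count≤-raise-≥ W K≤s) ⟩
      suc K + count≤ s W
        ≡⟨ cong (λ k → suc k + count≤ s W) (count≤-A-≥ K≤s) ⟨
      suc (count≤ s A + count≤ s W)
        ≡⟨ cong suc (count≤-++ s A W) ⟨
      suc (count≤ s (A ++ W))
        ≡⟨ cong (suc ∘ count≤ s) (prefix-+ T i) ⟨
      suc (count≤ s (take (K + i) (A ++ T)))
        ∎
      where
      open ≡.≡-Reasoning
      W = take i T

  module Rook₁Facts {A T} (A-rows : Pointwise _InRow_ A H) (T-rows : Pointwise _InRow_ T L)
                    (A++T! : Unique (A ++ T)) where

    A! : Unique A
    A! = proj₁ (Unique-++⁻ A A++T!)

    T! : Unique T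
    T! = proj₁ (proj₂ (Unique-++⁻ A A++T!))

    open FirstRows A-rows A! public

    T-free : All (Free K missing) T
    T-free = All.zipWith (λ (1≤v , v∉A) → ∉⇒free 1≤v v∉A)
      (rows-positive T-rows , All.tabulate (λ v∈T v∈A → proj₂ (proj₂ (Unique-++⁻ A A++T!)) (v∈A , v∈T)))

  module Rook₂Facts {A m Z} (A-rows : Pointwise _InRow_ A H) (m-row : m InRow suc K)
                    (Z-rows : Pointwise _InRow_ Z (map suc L)) (A++m∷Z! : Unique (A ++ m ∷ Z)) where

    A! : Unique A
    A! = proj₁ (Unique-++⁻ A A++m∷Z!)

    m∷Z! : Unique (m ∷ Z)
    m∷Z! = proj₁ (proj₂ (Unique-++⁻ A A++m∷Z!))

    A#m∷Z : Disjoint A (m ∷ Z)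
    A#m∷Z = proj₂ (proj₂ (Unique-++⁻ A A++m∷Z!))

    open FirstRows A-rows A! public

    m≡missing : m ≡ missing
    m≡missing = absent⇒missing m-row (λ m∈A → A#m∷Z (m∈A , here refl))

    Z-above : All (suc K <_) Z
    Z-above = All.tabulate λ {z} z∈Z →
      [ (λ z≡missing → contradiction (trans z≡missing (sym m≡missing)) (z≢m z∈Z)) , id ]′
      (∉⇒free (All.lookup (rows-positive Z-rows) z∈Z) (λ z∈A → A#m∷Z (z∈A , there z∈Z)))
      where
      z≢m : ∀ {z} → z ∈ Z → z ≢ m
      z≢m z∈Z z≡m = All¬⇒¬Any (AllPairs.head m∷Z!) (subst (_∈ Z) z≡m z∈Z)

  insertRow-valid : ∀ {x} → IsRook λ₁ x → IsRook λ₂ (insertRow x)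
  insertRow-valid rk with view₁ rk
  ... | rook₁ {A} {T} A-rows T-rows A++T! =
    subst (IsRook λ₂) (sym (insertRow-++ T))
      ( Pointwise.++⁺ A-rows (missing-InRow ∷ raise-rows T-rows L≥)
      , Unique.++⁺ A! (missing∉raisedT ∷ Unique-map⁺-on (raise-injective m≤) T-free T!) A#rest )
    where
    open Rook₁Facts A-rows T-rows A++T!
    m≤ = proj₂ missing-InRow
    missing∉raisedT : All (missing ≢_) (map raise T)
    missing∉raisedT = map⁺ (All.tabulate {xs = T} (λ {v} _ → <⇒≢ (≤-<-trans m≤ (raise-> v))))
    A#rest : Disjoint A (missing ∷ map raise T)
    A#rest (v∈A , here refl)     = missing-∉ v∈A
    A#rest (v∈A , there v∈raisedT) with w , _ , refl ← ∈-map⁻ raise v∈raisedT = free-∉ (inj₂ (raise-> w)) v∈A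

  deleteRow-valid : ∀ {y} → IsRook λ₂ y → IsRook λ₁ (deleteRow y)
  deleteRow-valid rk with view₂ rk
  ... | rook₂ {A} {m} {Z} A-rows m-row Z-rows A++m∷Z! =
    subst (IsRook λ₁) (sym (deleteRow-++ m Z))
      ( Pointwise.++⁺ A-rows (lower-rows m-row Z-above Z-rows L≥)
      , Unique.++⁺ A! (Unique-map⁺-on (lower-injective (proj₂ m-row)) Z-above (AllPairs.tail m∷Z!)) A#loweredZ )
    where
    open Rook₂Facts A-rows m-row Z-rows A++m∷Z!
    A#loweredZ : Disjoint A (map (lower m) Z)
    A#loweredZ (v∈A , v∈loweredZ) with z , z∈Z , refl ← ∈-map⁻ (lower m) v∈loweredZ =
      free-∉ (subst (λ m′ → Free K m′ (lower m z)) m≡missing (lower-free (All.lookup Z-above z∈Z))) v∈A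

  deleteRow∘insertRow : ∀ {x} → IsRook λ₁ x → deleteRow (insertRow x) ≡ x
  deleteRow∘insertRow rk with view₁ rk
  ... | rook₁ {A} {T} A-rows T-rows A++T! = begin
    deleteRow (insertRow (A ++ T))           ≡⟨ cong deleteRow (insertRow-++ T) ⟩
    deleteRow (A ++ missing ∷ map raise T)   ≡⟨ deleteRow-++ missing (map raise T) ⟩
    A ++ map (lower missing) (map raise T)   ≡⟨ cong (A ++_) (map-∘ T) ⟨
    A ++ map (lower missing ∘ raise) T       ≡⟨ cong (A ++_) (map-id-local (All.map (lower∘raise m≤) T-free)) ⟩
    A ++ T                                   ∎
    where
    open ≡.≡-Reasoning
    open Rook₁Facts A-rows T-rows A++T!
    m≤ = proj₂ missing-InRow

  insertRow∘deleteRow : ∀ {y} → IsRook λ₂ y → insertRow (deleteRow y) ≡ y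
  insertRow∘deleteRow rk with view₂ rk
  ... | rook₂ {A} {m} {Z} A-rows m-row Z-rows A++m∷Z! = begin
    insertRow (deleteRow (A ++ m ∷ Z))         ≡⟨ cong insertRow (deleteRow-++ m Z) ⟩
    insertRow (A ++ map (lower m) Z)           ≡⟨ insertRow-++ (map (lower m) Z) ⟩
    A ++ missing ∷ map raise (map (lower m) Z) ≡⟨ cong₂ (λ m′ Z′ → A ++ m′ ∷ Z′) m≡missing (map-∘ Z) ⟨
    A ++ m ∷ map (raise ∘ lower m) Z           ≡⟨ cong (λ Z′ → A ++ m ∷ Z′)
                                                       (map-id-local (All.map (raise∘lower (proj₂ m-row)) Z-above)) ⟩
    A ++ m ∷ Z                                 ∎
    where
    open ≡.≡-Reasoning
    open Rook₂Facts A-rows m-row Z-rows A++m∷Z!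

  insertRow-mono : ∀ {x y} → IsRook λ₁ x → IsRook λ₁ y → x ⊑ y → insertRow x ⊑ insertRow y
  insertRow-mono rx ry x⊑y with view₁ rx | view₁ ry
  ... | rook₁ {A} {T} A-rows T-rows A++T! | rook₁ {B} {U} B-rows U-rows B++U! =
    subst₂ _⊑_ (sym (X.insertRow-++ T)) (sym (Y.insertRow-++ U)) dom
    where
    module X = Rook₁Facts A-rows T-rows A++T!
    module Y = Rook₁Facts B-rows U-rows B++U!
    dom : (A ++ X.missing ∷ map raise T) ⊑ (B ++ Y.missing ∷ map raise U)
    dom j t with cut K j
    ... | below j≤K = subst₂ (λ b a → count≤ t b ≤ count≤ t a)
                        (sym (Y.inserted-below U j≤K)) (sym (X.inserted-below T j≤K)) (x⊑y j t)
    ... | above i with cut (suc K) t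
    ...   | below t≤ = ≤-reflexive (trans (Y.count≤-inserted-≤ U i t≤) (sym (X.count≤-inserted-≤ T i t≤)))
    ...   | above i′ = subst₂ _≤_ (sym (Y.count≤-inserted-≥ U i K<s)) (sym (X.count≤-inserted-≥ T i K<s))
                          (s≤s (x⊑y (K + i) (K + suc i′)))
      where
      K<s : suc K ≤ K + suc i′
      K<s = m<m+n K (s≤s z≤n)

  insertRow-reflects : ∀ {x y} → IsRook λ₁ x → IsRook λ₁ y → insertRow x ⊑ insertRow y → x ⊑ y
  insertRow-reflects rx ry ix⊑iy with view₁ rx | view₁ ry
  ... | rook₁ {A} {T} A-rows T-rows A++T! | rook₁ {B} {U} B-rows U-rows B++U! = dom
    where
    module X = Rook₁Facts A-rows T-rows A++T!
    module Y = Rook₁Facts B-rows U-rows B++U!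
    h : (A ++ X.missing ∷ map raise T) ⊑ (B ++ Y.missing ∷ map raise U)
    h = subst₂ _⊑_ (X.insertRow-++ T) (Y.insertRow-++ U) ix⊑iy
    dom : (A ++ T) ⊑ (B ++ U)
    dom j t with cut K j
    ... | below j≤K = subst₂ (λ b a → count≤ t b ≤ count≤ t a)
                        (Y.inserted-below U j≤K) (X.inserted-below T j≤K) (h j t)
    ... | above i with t ≤? K
    ...   | no t≰K  = ≤-pred (subst₂ _≤_ (Y.count≤-inserted-≥ U (suc i) (≰⇒> t≰K))
                                         (X.count≤-inserted-≥ T (suc i) (≰⇒> t≰K))
                                         (h (K + suc (suc i)) (suc t)))
    ...   | yes t≤K = subst₂ (λ b a → count≤ t b ≤ count≤ t a)
                        (sym (Y.prefix-+ U (suc i))) (sym (X.prefix-+ T (suc i)))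
                        (count≤-++-dominance {A = A} {B} {W} {V} (m≤n⇒m≤1+n t≤K) A++W! B++V! B++V⁺
                          (≤-reflexive (cong suc (sym (Y.count≤-A-≥ ≤-refl)))) B≼A B++V≼A++W)
      where
      W = take (suc i) T
      V = take (suc i) U
      A++W! : Unique (A ++ W)
      A++W! = subst Unique (X.prefix-+ T (suc i)) (Unique.take⁺ (K + suc i) A++T!)
      B++V! : Unique (B ++ V)
      B++V! = subst Unique (Y.prefix-+ U (suc i)) (Unique.take⁺ (K + suc i) B++U!)
      B++V⁺ : All (1 ≤_) (B ++ V)
      B++V⁺ = subst (All (1 ≤_)) (Y.prefix-+ U (suc i))
                (take⁺ (K + suc i) (++⁺ (rows-positive B-rows) (rows-positive U-rows)))
      B≼A : count≤ t B ≤ count≤ t A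
      B≼A = subst₂ (λ b a → count≤ t b ≤ count≤ t a) (Y.prefix-K _) (X.prefix-K _) (h K t)
      B++V≼A++W : count≤ (suc K) (B ++ V) ≤ count≤ (suc K) (A ++ W)
      B++V≼A++W = subst₂ (λ b a → count≤ (suc K) b ≤ count≤ (suc K) a)
                    (Y.prefix-+ U (suc i)) (X.prefix-+ T (suc i))
                    (≤-pred (subst₂ _≤_ (Y.count≤-inserted-≥ U (suc i) ≤-refl)
                                        (X.count≤-inserted-≥ T (suc i) ≤-refl)
                                        (h (K + suc (suc i)) (suc (suc K)))))

  rowInsertionIso : RookIso λ₁ λ₂
  rowInsertionIso = record
    { to      = λ (x , rk) → insertRow x , insertRow-valid rk
    ; from    = λ (y , rk) → deleteRow y , deleteRow-valid rk
    ; from∘to = λ (_ , rk) → deleteRow∘insertRow rk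
    ; to∘from = λ (_ , rk) → insertRow∘deleteRow rk
    ; to-mono = λ (_ , rx) (_ , ry) x≤y →
        ⊑⇒≤R (rooks-same-length (insertRow-valid rx) (insertRow-valid ry)) (insertRow-mono rx ry (≤R⇒⊑ x≤y))
    ; to-refl = λ (_ , rx) (_ , ry) ix≤iy →
        ⊑⇒≤R (rooks-same-length rx ry) (insertRow-reflects rx ry (≤R⇒⊑ ix≤iy))
    }

fromGJWFrom-gjwFrom : ∀ k λs → AboveFrom k λs → fromGJWFrom k (gjwFrom k λs) ≡ λs
fromGJWFrom-gjwFrom k []       _           = refl
fromGJWFrom-gjwFrom k (l ∷ ls) (k≤l , ls≥) = cong₂ _∷_ (m∸n+n≡m k≤l) (fromGJWFrom-gjwFrom (suc k) ls ls≥)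

fromGJWFrom-++ : ∀ k a c → fromGJWFrom k (a ++ c) ≡ fromGJWFrom k a ++ fromGJWFrom (length a + k) c
fromGJWFrom-++ k []      c = refl
fromGJWFrom-++ k (g ∷ a) c = cong ((g + k) ∷_)
  (trans (fromGJWFrom-++ (suc k) a c) (cong (λ k′ → fromGJWFrom (suc k) a ++ fromGJWFrom k′ c) (+-suc (length a) k)))

fromGJWFrom-suc : ∀ k b → fromGJWFrom (suc k) b ≡ map suc (fromGJWFrom k b)
fromGJWFrom-suc k []      = refl
fromGJWFrom-suc k (g ∷ b) = cong₂ _∷_ (+-suc g k) (fromGJWFrom-suc (suc k) b)

length-fromGJWFrom : ∀ k a → length (fromGJWFrom k a) ≡ length a
length-fromGJWFrom k []      = refl
length-fromGJWFrom k (g ∷ a) = cong suc (length-fromGJWFrom (suc k) a)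

fromGJWFrom-≥ : ∀ k b → All (k ≤_) (fromGJWFrom k b)
fromGJWFrom-≥ k []      = []
fromGJWFrom-≥ k (g ∷ b) = m≤n+m k g ∷ All.map (≤-trans (n≤1+n k)) (fromGJWFrom-≥ (suc k) b)

sorted-prefix-≤ : ∀ F {c rest} → Sorted (F ++ c ∷ rest) → All (_≤ c) F
sorted-prefix-≤ []      _     = []
sorted-prefix-≤ (f ∷ F) F++c↗ =
  All.lookup (sorted-head≤ F++c↗) (there (∈-++⁺ʳ F (here refl))) ∷ sorted-prefix-≤ F (Linked.tail F++c↗)

mainTheorem5 : (λs a b : List ℕ) → IsPartition λs → gjw λs ≡ a ++ (1 ∷ b)
    → RookIso λs (fromGJW (a ++ (1 ∷ 0 ∷ b)))
mainTheorem5 λs a b (λs↗ , λs≥) gjw≡ =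
  subst₂ RookIso (sym λs≡H++L) (sym λ′≡) (RowInsertion.rowInsertionIso K H L |H|≡K H≤ L≥)
  where
  K = length a + 1
  L = fromGJWFrom (suc K) b
  H = fromGJW a ++ [ suc K ]
  λs≡ : λs ≡ fromGJW a ++ suc K ∷ L
  λs≡ = trans (sym (fromGJWFrom-gjwFrom 1 λs λs≥)) (trans (cong fromGJW gjw≡) (fromGJWFrom-++ 1 a (1 ∷ b)))
  λs≡H++L : λs ≡ H ++ L
  λs≡H++L = trans λs≡ (sym (++-assoc (fromGJW a) [ suc K ] L))
  λ′≡ : fromGJW (a ++ 1 ∷ 0 ∷ b) ≡ H ++ suc K ∷ map suc L
  λ′≡ = trans (fromGJWFrom-++ 1 a (1 ∷ 0 ∷ b))
          (trans (cong (λ L′ → fromGJW a ++ suc K ∷ suc K ∷ L′) (fromGJWFrom-suc (suc K) b))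
                 (sym (++-assoc (fromGJW a) [ suc K ] _)))
  |H|≡K : length H ≡ K
  |H|≡K = trans (length-++ (fromGJW a)) (cong (_+ 1) (length-fromGJWFrom 1 a))
  H≤ : All (_≤ suc K) H
  H≤ = ++⁺ (sorted-prefix-≤ (fromGJW a) (subst Sorted λs≡ λs↗)) (≤-refl ∷ [])
  L≥ : All (suc K ≤_) L
  L≥ = fromGJWFrom-≥ (suc K) b
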